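{- For each $A \subseteq X$ define $S_{A} = \{ \alpha \in \mathbb{3}^{X} : Ann(\alpha) = I_{A} \}$, where $I_{A} = \{ \alpha \in \mathbb{3}^{X} : \alpha(y) = U \text{ for all } y \in A \}$. The collection $\{ S_{A} : A \subseteq X \}$ forms a partition of $\mathbb{3}^{X}$ in which all the elements of $\mathbb{2}^{X}$ (the $\{T,F\}$-valued functions) form a single equivalence class, namely $S_X = \mathbb{2}^X$.
   Context: $\mathbb{3} = \{T, F, U\}$ is McCarthy's three-valued logic: $\neg T = F$, $\neg F = T$, $\neg U = U$; $T \wedge y = y$, $F \wedge y = F$, $U \wedge y = U$; $T \vee y = T$, $F \vee y = y$, $U \vee y = U$. For a set $X$, $\mathbb{3}^{X}$ carries the pointwise operations, with constant ${\bf U}$ identically $U$. For $a \in \mathbb{3}^X$, $Ann(a) = \{ \alpha \in \mathbb{3}^X : (\alpha \wedge a) \vee (\neg \alpha \wedge a) = {\bf U} \}$. -}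

module Defs where

open import Data.Bool using (Bool; true; false)
open import Data.Product using (_×_; Σ)
open import Data.Sum using (_⊎_)
open import Relation.Binary.PropositionalEquality using (_≡_)

-- McCarthy's three-valued logic 𝟛 = {T, F, U}
data Three : Set where
  T F U : Three

¬₃_ : Three → Three
¬₃ T = F
¬₃ F = T
¬₃ U = U

_∧₃_ : Three → Three → Three
T ∧₃ y = y
F ∧₃ y = F
U ∧₃ y = U

_∨₃_ : Three → Three → Three
T ∨₃ y = T
F ∨₃ y = y
U ∨₃ y = U

3^ : Set → Set
3^ X = X → Three

module _ {X : Set} where

  ¬ᵖ_ : 3^ X → 3^ X
  (¬ᵖ a) x = ¬₃ (a x)

  _∧ᵖ_ : 3^ X → 3^ X → 3^ X
  (a ∧ᵖ b) x = a x ∧₃ b x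

  _∨ᵖ_ : 3^ X → 3^ X → 3^ X
  (a ∨ᵖ b) x = a x ∨₃ b x

  𝐔 : 3^ X
  𝐔 _ = U

  _≐_ : 3^ X → 3^ X → Set
  a ≐ b = ∀ x → a x ≡ b x

  Ann : 3^ X → 3^ X → Set
  Ann a α = ((α ∧ᵖ a) ∨ᵖ ((¬ᵖ α) ∧ᵖ a)) ≐ 𝐔

  Subset : Set
  Subset = X → Bool

  _∈ₛ_ : X → Subset → Set
  y ∈ₛ A = A y ≡ true

  fullSet : Subset
  fullSet _ = true

  I : Subset → 3^ X → Set
  I A α = ∀ y → y ∈ₛ A → α y ≡ U

  _≋_ : (3^ X → Set) → (3^ X → Set) → Set
  P ≋ Q = ∀ β → (P β → Q β) × (Q β → P β)

  S : Subset → 3^ X → Set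
  S A α = Ann α ≋ I A

  Two^ : 3^ X → Set
  Two^ α = ∀ x → (α x ≡ T) ⊎ (α x ≡ F)

module Submission where

-- Call x a point of definedness of α when α x ≠ U, and let
-- support α ⊆ X be the set of such points.  A pointwise case analysis on 𝟛
-- shows that (β ∧ a) ∨ (¬β ∧ a) = U exactly when a = U or β = U, hence
--   Ann(α) = I_{support α}.
-- The map A ↦ I_A is injective (test I_A against the function that is U on A
-- and T elsewhere), so Ann(α) = I_A holds iff A = support α, i.e.
--   S_A = { α : support α = A }.
-- The theorem is then a corollary of this characterisation: the blocks S_A
-- are the fibres of the map `support`, which is surjective (A is the support
-- of the function that is T on A and U elsewhere), and S_X consists of the
-- everywhere defined functions, which are precisely the {T,F}-valued ones.

open import Defs
open import Data.Bool using (Bool; true; false; if_then_else_)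
open import Data.Product using (_×_; Σ; _,_; proj₁; proj₂)
open import Data.Sum using (_⊎_; inj₁; inj₂)
open import Relation.Binary.PropositionalEquality using (_≡_; refl; sym; trans)

defined : Three → Bool
defined T = true
defined F = true
defined U = false

annihilates-defined : (a b : Three) → defined a ≡ true →
                      ((b ∧₃ a) ∨₃ ((¬₃ b) ∧₃ a)) ≡ U → b ≡ U
annihilates-defined T U _ _ = refl
annihilates-defined F U _ _ = refl
annihilates-defined T T _ ()
annihilates-defined T F _ ()
annihilates-defined F T _ ()
annihilates-defined F F _ ()

annihilates-if : (a b : Three) → (defined a ≡ true → b ≡ U) →
                 ((b ∧₃ a) ∨₃ ((¬₃ b) ∧₃ a)) ≡ U
annihilates-if U T _ = refl
annihilates-if U F _ = refl
annihilates-if U U _ = refl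
annihilates-if T b b≡U with b≡U refl
... | refl = refl
annihilates-if F b b≡U with b≡U refl
... | refl = refl

defined⇒classical : (t : Three) → defined t ≡ true → (t ≡ T) ⊎ (t ≡ F)
defined⇒classical T _ = inj₁ refl
defined⇒classical F _ = inj₂ refl

classical⇒defined : (t : Three) → (t ≡ T) ⊎ (t ≡ F) → defined t ≡ true
classical⇒defined T _ = refl
classical⇒defined F _ = refl
classical⇒defined U (inj₁ ())
classical⇒defined U (inj₂ ())

bool-antisym : (a b : Bool) → (a ≡ true → b ≡ true) → (b ≡ true → a ≡ true) → a ≡ b
bool-antisym true  b a⇒b _   = sym (a⇒b refl)
bool-antisym false true _ b⇒a = b⇒a refl
bool-antisym false false _ _  = refl

module _ {X : Set} where

  support : 3^ X → Subset {X}
  support α x = defined (α x)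

  ≋-sym : {P Q : 3^ X → Set} → P ≋ Q → Q ≋ P
  ≋-sym P≋Q β = proj₂ (P≋Q β) , proj₁ (P≋Q β)

  ≋-trans : {P Q R : 3^ X → Set} → P ≋ Q → Q ≋ R → P ≋ R
  ≋-trans P≋Q Q≋R β = (λ p → proj₁ (Q≋R β) (proj₁ (P≋Q β) p))
                    , (λ r → proj₂ (P≋Q β) (proj₂ (Q≋R β) r))

  Ann≋I-support : (α : 3^ X) → Ann α ≋ I (support α)
  Ann≋I-support α β =
      (λ ann y y∈supp → annihilates-defined (α y) (β y) y∈supp (ann y))
    , (λ β∈I y → annihilates-if (α y) (β y) (β∈I y))

  I-cong : {A B : Subset {X}} → (∀ x → A x ≡ B x) → I A ≋ I B
  I-cong A≗B β = (λ β∈IA y y∈B → β∈IA y (trans (A≗B y) y∈B))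
               , (λ β∈IB y y∈A → β∈IB y (trans (sym (A≗B y)) y∈A))

  vanishing-on : Subset {X} → 3^ X
  vanishing-on A x = if A x then U else T

  vanishing-on-∈I : (A : Subset {X}) → I A (vanishing-on A)
  vanishing-on-∈I A y y∈A with A y
  ... | true = refl

  -- I_A ⊆ I_B forces B ⊆ A: the witness vanishing-on A is U exactly on A.
  I-antitone : {A B : Subset {X}} → (∀ β → I A β → I B β) →
               ∀ x → B x ≡ true → A x ≡ true
  I-antitone {A} IA⊆IB x x∈B = off-A⇒T (IA⊆IB (vanishing-on A) (vanishing-on-∈I A) x x∈B)
    where
      off-A⇒T : vanishing-on A x ≡ U → A x ≡ true
      off-A⇒T _ with A x
      off-A⇒T _    | true = refl
      off-A⇒T () | false

  I-injective : {A B : Subset {X}} → I A ≋ I B → ∀ x → A x ≡ B x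
  I-injective {A} {B} IA≋IB x =
    bool-antisym (A x) (B x)
      (I-antitone (λ β → proj₂ (IA≋IB β)) x)
      (I-antitone (λ β → proj₁ (IA≋IB β)) x)

  S⇒support : {A : Subset {X}} {α : 3^ X} → S A α → ∀ x → support α x ≡ A x
  S⇒support {A} {α} α∈SA = I-injective (≋-trans (≋-sym (Ann≋I-support α)) α∈SA)

  support⇒S : {A : Subset {X}} {α : 3^ X} → (∀ x → support α x ≡ A x) → S A α
  support⇒S {A} {α} supp≗A = ≋-trans (Ann≋I-support α) (I-cong supp≗A)

  defined-on : Subset {X} → 3^ X
  defined-on A x = if A x then T else U

  support-defined-on : (A : Subset {X}) → ∀ x → support (defined-on A) x ≡ A x
  support-defined-on A x with A x
  ... | true  = refl
  ... | false = refl

theorem4p15 : (X : Set) →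
    ((A : Subset {X}) → Σ (3^ X) (λ α → S A α))
    × ((α : 3^ X) → Σ (Subset {X}) (λ A → S A α))
    × ((A B : Subset {X}) (α : 3^ X) → S A α → S B α → (∀ x → A x ≡ B x))
    × ((α : 3^ X) → (S fullSet α → Two^ α) × (Two^ α → S fullSet α))
theorem4p15 X = nonempty , covering , disjoint , (λ α → full⇒two α , two⇒full α)
  where
    nonempty : (A : Subset {X}) → Σ (3^ X) (λ α → S A α)
    nonempty A = defined-on A , support⇒S (support-defined-on A)

    covering : (α : 3^ X) → Σ (Subset {X}) (λ A → S A α)
    covering α = support α , support⇒S (λ _ → refl)

    disjoint : (A B : Subset {X}) (α : 3^ X) → S A α → S B α → ∀ x → A x ≡ B x
    disjoint A B α α∈SA α∈SB x = trans (sym (S⇒support α∈SA x)) (S⇒support α∈SB x)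

    full⇒two : (α : 3^ X) → S fullSet α → Two^ α
    full⇒two α α∈SX x = defined⇒classical (α x) (S⇒support α∈SX x)

    two⇒full : (α : 3^ X) → Two^ α → S fullSet α
    two⇒full α classical = support⇒S (λ x → classical⇒defined (α x) (classical x))
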